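{- Let $m\geq 1$ and let $\Lambda_m\supseteq\Delta_m$ be the lattices defined below. Let $\ell\in\Lambda_m$ be a minimal vector, i.e. $(\ell,\ell)=2^{m-1}$. Then for every $x\in\ell+\Delta_m$ either $(x,x)=2^{m-1}$ or $(x,x)\geq 2^m$.
   Context: Let $N=2^m$, let $\mathcal{V}_m=\mathbb{F}_2^m$ with a fixed basis $(v_1,\ldots,v_m)$, and let $(e_v\mid v\in\mathcal{V}_m)$ be an orthonormal basis of the Euclidean space $(\mathbb{R}^N,(\cdot,\cdot))$ indexed by $\mathcal{V}_m$. For a subset $\mathcal{U}\subseteq\mathcal{V}_m$ put $x_{\mathcal{U}}=\sum_{v\in\mathcal{U}}e_v$. For $\lambda=(\lambda_0,\ldots,\lambda_m)\in\mathbb{Z}^{m+1}$ define $\Lambda(\lambda)$ as the $\mathbb{Z}$-span of all vectors $2^{\lambda_{m-r}}x_{\mathcal{U}}$, where $0\leq r\leq m$ and $\mathcal{U}$ runs over the affine subspaces of $\mathcal{V}_m$ of dimension $r$. Put $\Lambda_m=\Lambda(\lambda)$ with $\lambda_r=\lfloor r/2\rfloor$ and $\Delta_m=\Lambda(\mu)$ with $\mu_r=\lfloor (r+1)/2\rfloor$ ($0\leq r\leq m$). Then $2\Lambda_m\subseteq\Delta_m\subseteq\Lambda_m$, $\min(\Lambda_m)=2^{m-1}$ and $\min(\Delta_m)=2^m$, where $\min$ denotes the smallest norm $(x,x)$ of a nonzero lattice vector. -}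

module Defs where

open import Data.Bool using (Bool; true; false; _xor_)
open import Data.Bool.Properties using () renaming (_≟_ to _≟ᵇ_)
open import Data.Nat as ℕ using (ℕ; zero; suc; _∸_; _≤_)
open import Data.Integer as ℤ using (ℤ; +_; _+_; _*_)
open import Data.Vec using (Vec; []; _∷_; replicate; zipWith)
open import Data.Vec.Properties using (≡-dec)
open import Data.List using (List; []; _∷_; map; _++_; foldr)
open import Relation.Binary.PropositionalEquality using (_≡_)
open import Relation.Nullary using (yes; no)

V : ℕ → Set
V m = Vec Bool m

0V : ∀ {m} → V m
0V = replicate _ false

_⊕_ : ∀ {m} → V m → V m → V m
_⊕_ = zipWith _xor_

_≟V_ : ∀ {m} (u v : V m) → Relation.Nullary.Dec (u ≡ v)
_≟V_ = ≡-dec _≟ᵇ_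

allV : (m : ℕ) → List (V m)
allV zero = [] ∷ []
allV (suc m) = map (false ∷_) (allV m) ++ map (true ∷_) (allV m)

comb : ∀ {m r} → Vec Bool r → Vec (V m) r → V m
comb [] [] = 0V
comb (false ∷ c) (_ ∷ w) = comb c w
comb (true ∷ c) (wᵢ ∷ w) = wᵢ ⊕ comb c w

LinIndep : ∀ {m r} → Vec (V m) r → Set
LinIndep {m} {r} w = ∀ (c : Vec Bool r) → comb c w ≡ 0V → c ≡ replicate r false

-- Vectors of ℝ^N with integer coordinates w.r.t. the basis (e_v | v ∈ 𝒱_m).
-- (All lattices considered lie in this ℤ-span.)
Vect : ℕ → Set
Vect m = V m → ℤ

sumL : List ℤ → ℤ
sumL = foldr _+_ (+ 0)

inner : ∀ {m} → Vect m → Vect m → ℤ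
inner {m} x y = sumL (map (λ v → x v * y v) (allV m))

norm : ∀ {m} → Vect m → ℤ
norm x = inner x x

e : ∀ {m} → V m → Vect m
e v u with u ≟V v
... | yes _ = + 1
... | no _ = + 0

-- x_𝒰 for the affine subspace 𝒰 = a + span(w₁,…,w_r) (w linearly independent,
-- so the parametrisation c ↦ a + Σ cᵢwᵢ is a bijection F₂^r → 𝒰):
-- x_𝒰 = Σ_{u ∈ 𝒰} e_u
xAff : ∀ {m r} → V m → Vec (V m) r → Vect m
xAff {m} {r} a w v = sumL (map (λ c → e (a ⊕ comb c w) v) (allV r))

-- Λ(λ): ℤ-span of all 2^{λ_{m-r}} x_𝒰, 𝒰 affine subspace of dimension r, 0 ≤ r ≤ m.
-- Exponents given as a function ℕ → ℕ (only λ_0..λ_m are used).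
data InLattice (m : ℕ) (lam : ℕ → ℕ) : Vect m → Set where
  zeroL : InLattice m lam (λ _ → + 0)
  addGen : ∀ {x} (r : ℕ) → r ≤ m → (a : V m) (w : Vec (V m) r) → LinIndep w →
           (k : ℤ) → InLattice m lam x →
           InLattice m lam (λ v → x v + k * ((+ (2 ℕ.^ lam (m ∸ r))) * xAff a w v))
  ext : ∀ {x y} → InLattice m lam x → (∀ v → x v ≡ y v) → InLattice m lam y

lamΛ : ℕ → ℕ
lamΛ r = r ℕ./ 2

lamΔ : ℕ → ℕ
lamΔ r = suc r ℕ./ 2

Λ : (m : ℕ) → Vect m → Set
Λ m = InLattice m lamΛ

Δ : (m : ℕ) → Vect m → Set
Δ m = InLattice m lamΔ

module Submission where

-- Λ_m and Δ_m lie in the lattices BW m 0 and BW m 1 of the Barnes–Wall type family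
-- BW (m+1) j = {(a , b) | a, b ∈ BW m j, a − b ∈ BW m (j+1)}, BW 0 j = 2^⌊j/2⌋ℤ, where (a , b)
-- splits a vector along the first coordinate of 𝒱; nonzero vectors of BW (n+1) j have norm ≥ 2^(j+n).
-- The statement is proved for any ℓ of norm 2^(j+n) in BW (n+1) j and d ∈ BW (n+1) (j+1):
--  * j ↦ j+1: the Hadamard map (a , b) ↦ (a+b , a−b) doubles norms and sends BW (n+1) (j+1) into
--    BW (n+1) (j+2) = 2·BW (n+1) j, so it turns an instance at level j+1 into one at level j.
--  * (n , 1) ↦ (n+1 , 0): a coordinate permutation of 𝒱 preserving every BW moves ℓ to (0 , b).
--    For d = (c , c′) the norm of ℓ + d is ‖c‖ + ‖b + c′‖; if neither summand vanishes both are
--    ≥ 2^(n+1), and otherwise (b , c′) or (−b , c − c′) is an instance in one dimension less.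

open import Defs
open import Data.Bool using (true; false; not; _xor_)
open import Data.Bool.Properties using (xor-assoc; xor-comm; xor-same)
open import Data.Integer as ℤ using (ℤ; +_; -[1+_]; _+_; _-_; -_; _*_; ∣_∣) renaming (_≤_ to _≤ℤ_)
import Data.Integer.Properties as ℤ
open import Data.Integer.Divisibility.Signed
  using (_∣_; divides; ∣ᵤ⇒∣; ∣⇒∣ᵤ; ∣-trans; ∣-reflexive; ∣m∣n⇒∣m+n; ∣n⇒∣m*n; ∣m⇒∣m*n; *-monoʳ-∣; *-cancelˡ-∣)
open import Data.Integer.Tactic.RingSolver using (solve-∀)
open import Data.List using (List; []; _∷_; map; _++_)
import Data.List.Properties as List
open import Data.Nat as ℕ using (ℕ; zero; suc; _≤_; _∸_; _^_; z≤n; s≤s)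
import Data.Nat.Properties as ℕ
import Data.Nat.Divisibility as ℕ
open import Data.Nat.DivMod using (m≡m%n+[m/n]*n; m%n<n)
import Data.Nat.Tactic.RingSolver as ℕ
open import Algebra.Properties.CommutativeSemigroup ℕ.+-commutativeSemigroup
  using () renaming (interchange to +-interchange)
open import Algebra.Properties.CommutativeSemigroup ℤ.+-commutativeSemigroup
  using () renaming (interchange to +-interchangeℤ)
open import Data.Product using (Σ; _×_; _,_; proj₁; proj₂)
open import Data.Empty using (⊥-elim)
open import Data.Sum using (_⊎_; inj₁; inj₂; reduce)
import Data.Sum
open import Data.Vec using (Vec; []; _∷_)
open import Data.Vec.Properties using (zipWith-assoc; zipWith-comm)
open import Function using (_∘_)
open import Relation.Binary.PropositionalEquality
open import Relation.Nullary using (¬_; Dec; yes; no)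

private variable
  n : ℕ

2^⌊_/2⌋ : ℕ → ℕ
2^⌊ 0 /2⌋ = 1
2^⌊ 1 /2⌋ = 1
2^⌊ suc (suc j) /2⌋ = 2 ℕ.* 2^⌊ j /2⌋

2^⌊/2⌋∣2^⌊suc/2⌋ : ∀ j → 2^⌊ j /2⌋ ℕ.∣ 2^⌊ suc j /2⌋
2^⌊/2⌋∣2^⌊suc/2⌋ 0 = ℕ.∣-refl
2^⌊/2⌋∣2^⌊suc/2⌋ 1 = ℕ.divides 2 refl
2^⌊/2⌋∣2^⌊suc/2⌋ (suc (suc j)) = ℕ.*-monoʳ-∣ 2 (2^⌊/2⌋∣2^⌊suc/2⌋ j)

2^⌊suc/2⌋∣2*2^⌊/2⌋ : ∀ j → 2^⌊ suc j /2⌋ ℕ.∣ 2 ℕ.* 2^⌊ j /2⌋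
2^⌊suc/2⌋∣2*2^⌊/2⌋ 0 = ℕ.divides 2 refl
2^⌊suc/2⌋∣2*2^⌊/2⌋ 1 = ℕ.∣-refl
2^⌊suc/2⌋∣2*2^⌊/2⌋ (suc (suc j)) = ℕ.*-monoʳ-∣ 2 (2^⌊suc/2⌋∣2*2^⌊/2⌋ j)

2^⌊/2⌋∣2^ : ∀ j k → j ≤ 2 ℕ.* k ℕ.+ 1 → 2^⌊ j /2⌋ ℕ.∣ 2 ^ k
2^⌊/2⌋∣2^ 0 k _ = ℕ.1∣ _
2^⌊/2⌋∣2^ 1 k _ = ℕ.1∣ _
2^⌊/2⌋∣2^ (suc (suc j)) 0 (s≤s ())
2^⌊/2⌋∣2^ (suc (suc j)) (suc k) j+2≤2k+3 =
  ℕ.*-monoʳ-∣ 2 (2^⌊/2⌋∣2^ j k (ℕ.≤-pred (ℕ.≤-pred (ℕ.≤-trans j+2≤2k+3 (ℕ.≤-reflexive (2k+3 k))))))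
  where
  2k+3 : ∀ k → 2 ℕ.* suc k ℕ.+ 1 ≡ suc (suc (2 ℕ.* k ℕ.+ 1))
  2k+3 k = cong (ℕ._+ 1) (ℕ.*-suc 2 k)

infixl 6 _+ᵛ_ _-ᵛ_
infixr 7 _·ᵛ_

_+ᵛ_ _-ᵛ_ : Vect n → Vect n → Vect n
(x +ᵛ y) v = x v + y v
(x -ᵛ y) v = x v - y v

-ᵛ_ : Vect n → Vect n
(-ᵛ x) v = - x v

_·ᵛ_ : ℤ → Vect n → Vect n
(k ·ᵛ x) v = k * x v

0ᵛ : Vect n
0ᵛ _ = + 0

lower upper : Vect (suc n) → Vect n
lower x v = x (false ∷ v)
upper x v = x (true ∷ v)

_∥_ : Vect n → Vect n → Vect (suc n)
(x ∥ y) (false ∷ v) = x v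
(x ∥ y) (true ∷ v) = y v

translate : V n → Vect n → Vect n
translate t x v = x (t ⊕ v)

sub-interchange : ∀ a b c d → (a - b) + (c - d) ≡ (a + c) - (b + d)
sub-interchange = solve-∀

*-distribˡ-- : ∀ k a b → k * (a - b) ≡ k * a - k * b
*-distribˡ-- = solve-∀

neg-sub : ∀ a b → - (a - b) ≡ b - a
neg-sub = solve-∀

neg[0-a]≡a : ∀ a → - (+ 0 - a) ≡ a
neg[0-a]≡a = solve-∀

BW : (n j : ℕ) → Vect n → Set
BW zero    j x = + 2^⌊ j /2⌋ ∣ x []
BW (suc n) j x = BW n j (lower x) × BW n j (upper x) × BW n (suc j) (lower x -ᵛ upper x)

BW-cong : ∀ n j {x y : Vect n} → x ≗ y → BW n j x → BW n j y
BW-cong zero    j x≗y (divides q eq) = divides q (trans (sym (x≗y [])) eq)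
BW-cong (suc n) j x≗y (x₀∈ , x₁∈ , x₀-x₁∈) =
  BW-cong n j (x≗y ∘ (false ∷_)) x₀∈ , BW-cong n j (x≗y ∘ (true ∷_)) x₁∈ ,
  BW-cong n (suc j) (λ v → cong₂ _-_ (x≗y (false ∷ v)) (x≗y (true ∷ v))) x₀-x₁∈

BW-0 : ∀ n j → BW n j 0ᵛ
BW-0 zero    j = divides (+ 0) refl
BW-0 (suc n) j = BW-0 n j , BW-0 n j , BW-0 n (suc j)

BW-+ : ∀ n j {x y : Vect n} → BW n j x → BW n j y → BW n j (x +ᵛ y)
BW-+ zero    j x∈ y∈ = ∣m∣n⇒∣m+n x∈ y∈
BW-+ (suc n) j {x} {y} (x₀∈ , x₁∈ , x₀-x₁∈) (y₀∈ , y₁∈ , y₀-y₁∈) =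
  BW-+ n j x₀∈ y₀∈ , BW-+ n j x₁∈ y₁∈ ,
  BW-cong n (suc j) (λ v → sub-interchange (x (false ∷ v)) (x (true ∷ v)) (y (false ∷ v)) (y (true ∷ v)))
    (BW-+ n (suc j) x₀-x₁∈ y₀-y₁∈)

BW-· : ∀ n j k {x : Vect n} → BW n j x → BW n j (k ·ᵛ x)
BW-· zero    j k x∈ = ∣n⇒∣m*n k x∈
BW-· (suc n) j k {x} (x₀∈ , x₁∈ , x₀-x₁∈) =
  BW-· n j k x₀∈ , BW-· n j k x₁∈ ,
  BW-cong n (suc j) (λ v → *-distribˡ-- k (x (false ∷ v)) (x (true ∷ v))) (BW-· n (suc j) k x₀-x₁∈)

BW-neg : ∀ n j {x : Vect n} → BW n j x → BW n j (-ᵛ x)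
BW-neg n j {x} x∈ = BW-cong n j (ℤ.-1*i≡-i ∘ x) (BW-· n j (ℤ.- + 1) x∈)

BW-- : ∀ n j {x y : Vect n} → BW n j x → BW n j y → BW n j (x -ᵛ y)
BW-- n j x∈ y∈ = BW-+ n j x∈ (BW-neg n j y∈)

BW-weaken : ∀ n j {x : Vect n} → BW n (suc j) x → BW n j x
BW-weaken zero    j x∈ = ∣-trans (∣ᵤ⇒∣ (2^⌊/2⌋∣2^⌊suc/2⌋ j)) x∈
BW-weaken (suc n) j (x₀∈ , x₁∈ , x₀-x₁∈) = BW-weaken n j x₀∈ , BW-weaken n j x₁∈ , BW-weaken n (suc j) x₀-x₁∈

BW-double : ∀ n j {x : Vect n} → BW n j x → BW n (2 ℕ.+ j) (+ 2 ·ᵛ x)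
BW-double zero    j x∈ = ∣-trans (∣-reflexive (ℤ.pos-* 2 2^⌊ j /2⌋)) (*-monoʳ-∣ (+ 2) x∈)
BW-double (suc n) j {x} (x₀∈ , x₁∈ , x₀-x₁∈) =
  BW-double n j x₀∈ , BW-double n j x₁∈ ,
  BW-cong n (3 ℕ.+ j) (λ v → *-distribˡ-- (+ 2) (x (false ∷ v)) (x (true ∷ v))) (BW-double n (suc j) x₀-x₁∈)

BW-even : ∀ n j {x : Vect n} → BW n (2 ℕ.+ j) x → ∀ v → + 2 ∣ x v
BW-even zero    j x∈ [] = ∣-trans (∣ᵤ⇒∣ (ℕ.m∣m*n 2^⌊ j /2⌋)) x∈
BW-even (suc n) j (x₀∈ , x₁∈ , _) (false ∷ v) = BW-even n j x₀∈ v
BW-even (suc n) j (x₀∈ , x₁∈ , _) (true ∷ v)  = BW-even n j x₁∈ v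

BW-half : ∀ n j {x : Vect n} → BW n (2 ℕ.+ j) (+ 2 ·ᵛ x) → BW n j x
BW-half zero    j x∈ = *-cancelˡ-∣ (+ 2) (∣-trans (∣-reflexive (sym (ℤ.pos-* 2 2^⌊ j /2⌋))) x∈)
BW-half (suc n) j {x} (x₀∈ , x₁∈ , x₀-x₁∈) =
  BW-half n j x₀∈ , BW-half n j x₁∈ ,
  BW-half n (suc j) (BW-cong n (3 ℕ.+ j) (λ v → sym (*-distribˡ-- (+ 2) (x (false ∷ v)) (x (true ∷ v)))) x₀-x₁∈)

BW-halve : ∀ n j {x : Vect n} → BW n (2 ℕ.+ j) x → Σ (Vect n) λ y → x ≗ + 2 ·ᵛ y × BW n j y
BW-halve n j {x} x∈ = y , x≗2y , BW-half n j (BW-cong n (2 ℕ.+ j) x≗2y x∈)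
  where
  y : Vect _
  y v = _∣_.quotient (BW-even n j x∈ v)
  x≗2y : x ≗ + 2 ·ᵛ y
  x≗2y v = trans (_∣_.equality (BW-even n j x∈ v)) (ℤ.*-comm _ (+ 2))

BW-translate : ∀ n j (t : V n) {x : Vect n} → BW n j x → BW n j (translate t x)
BW-translate zero    j []          x∈                 = x∈
BW-translate (suc n) j (false ∷ t) (x₀∈ , x₁∈ , x₀-x₁∈) =
  BW-translate n j t x₀∈ , BW-translate n j t x₁∈ , BW-translate n (suc j) t x₀-x₁∈
BW-translate (suc n) j (true ∷ t) {x} (x₀∈ , x₁∈ , x₀-x₁∈) =
  BW-translate n j t x₁∈ , BW-translate n j t x₀∈ ,
  BW-cong n (suc j) (λ v → neg-sub (x (false ∷ t ⊕ v)) (x (true ∷ t ⊕ v)))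
    (BW-neg n (suc j) (BW-translate n (suc j) t x₀-x₁∈))

BW-+translate : ∀ n j (t : V n) {x : Vect n} → BW n j x → BW n (suc j) (x +ᵛ translate t x)
BW-+translate zero j [] {x} x∈ =
  ∣-trans (∣ᵤ⇒∣ (2^⌊suc/2⌋∣2*2^⌊/2⌋ j))
    (∣-trans (∣-reflexive (ℤ.pos-* 2 2^⌊ j /2⌋)) (∣-trans (*-monoʳ-∣ (+ 2) x∈) (∣-reflexive (2·a≡a+a (x [])))))
  where
  2·a≡a+a : ∀ a → + 2 * a ≡ a + a
  2·a≡a+a = solve-∀
BW-+translate (suc n) j (false ∷ t) {x} (x₀∈ , x₁∈ , x₀-x₁∈) =
  BW-+translate n j t x₀∈ , BW-+translate n j t x₁∈ ,
  BW-cong n (2 ℕ.+ j) (λ v → sub-interchange (x (false ∷ v)) (x (true ∷ v)) (x (false ∷ t ⊕ v)) (x (true ∷ t ⊕ v)))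
    (BW-+translate n (suc j) t x₀-x₁∈)
BW-+translate (suc n) j (true ∷ t) {x} (x₀∈ , x₁∈ , x₀-x₁∈) =
  BW-cong n (suc j) (λ v → lowerEq (x (false ∷ v)) (x (true ∷ v)) (x (true ∷ t ⊕ v)))
    (BW-+ n (suc j) x₀-x₁∈ (BW-+translate n j t x₁∈)) ,
  BW-cong n (suc j) (λ v → upperEq (x (false ∷ v)) (x (true ∷ v)) (x (false ∷ t ⊕ v)))
    (BW-- n (suc j) (BW-+translate n j t x₀∈) x₀-x₁∈) ,
  BW-cong n (2 ℕ.+ j) (λ v → diffEq (x (false ∷ v)) (x (true ∷ v)) (x (false ∷ t ⊕ v)) (x (true ∷ t ⊕ v)))
    (BW-- n (2 ℕ.+ j) (BW-+translate n (suc j) t x₀-x₁∈)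
      (BW-weaken n (2 ℕ.+ j) (BW-double n (suc j) (BW-translate n (suc j) t x₀-x₁∈))))
  where
  lowerEq : ∀ a b tb → (a - b) + (b + tb) ≡ a + tb
  lowerEq = solve-∀
  upperEq : ∀ a b ta → (a + ta) - (a - b) ≡ b + ta
  upperEq = solve-∀
  diffEq : ∀ a b ta tb → ((a - b) + (ta - tb)) - + 2 * (ta - tb) ≡ (a + tb) - (b + ta)
  diffEq = solve-∀

⊕-involutive : ∀ (w p : V n) → w ⊕ (w ⊕ p) ≡ p
⊕-involutive []      []      = refl
⊕-involutive (b ∷ w) (c ∷ p) =
  cong₂ _∷_ (trans (sym (xor-assoc b b c)) (cong (_xor c) (xor-same b))) (⊕-involutive w p)

⊕-leftComm : ∀ (a w p : V n) → a ⊕ (w ⊕ p) ≡ w ⊕ (a ⊕ p)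
⊕-leftComm a w p = begin
  a ⊕ (w ⊕ p)  ≡⟨ zipWith-assoc xor-assoc a w p ⟨
  (a ⊕ w) ⊕ p  ≡⟨ cong (_⊕ p) (zipWith-comm xor-comm a w) ⟩
  (w ⊕ a) ⊕ p  ≡⟨ zipWith-assoc xor-assoc w a p ⟩
  w ⊕ (a ⊕ p)  ∎
  where open ≡-Reasoning

e-translate : ∀ (w p v : V n) → e (w ⊕ p) v ≡ e p (w ⊕ v)
e-translate w p v with v ≟V (w ⊕ p) | (w ⊕ v) ≟V p
... | yes _    | yes _    = refl
... | no  _    | no  _    = refl
... | yes refl | no  w⊕v≢p = ⊥-elim (w⊕v≢p (⊕-involutive w p))
... | no  v≢w⊕p | yes refl = ⊥-elim (v≢w⊕p (sym (⊕-involutive w v)))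

e-0-false : ∀ (v : V n) → e 0V (false ∷ v) ≡ e 0V v
e-0-false v with v ≟V 0V
... | yes _ = refl
... | no  _ = refl

sumL-++ : ∀ (xs ys : List ℤ) → sumL (xs ++ ys) ≡ sumL xs + sumL ys
sumL-++ []       ys = sym (ℤ.+-identityˡ (sumL ys))
sumL-++ (x ∷ xs) ys = trans (cong (_+_ x) (sumL-++ xs ys)) (sym (ℤ.+-assoc x (sumL xs) (sumL ys)))

sumL-allV-suc : ∀ (f : V (suc n) → ℤ) →
  sumL (map f (allV (suc n))) ≡ sumL (map (f ∘ (false ∷_)) (allV n)) + sumL (map (f ∘ (true ∷_)) (allV n))
sumL-allV-suc {n} f = begin
  sumL (map f (map (false ∷_) A ++ map (true ∷_) A))
    ≡⟨ cong sumL (List.map-++ f (map (false ∷_) A) (map (true ∷_) A)) ⟩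
  sumL (map f (map (false ∷_) A) ++ map f (map (true ∷_) A))
    ≡⟨ sumL-++ (map f (map (false ∷_) A)) (map f (map (true ∷_) A)) ⟩
  sumL (map f (map (false ∷_) A)) + sumL (map f (map (true ∷_) A))
    ≡⟨ cong₂ (λ xs ys → sumL xs + sumL ys) (List.map-∘ A) (List.map-∘ A) ⟨
  sumL (map (f ∘ (false ∷_)) A) + sumL (map (f ∘ (true ∷_)) A) ∎
  where
  open ≡-Reasoning
  A = allV n

xAff-[] : ∀ (a : V n) → xAff a [] ≗ translate a (e 0V)
xAff-[] a v = trans (ℤ.+-identityʳ _) (e-translate a 0V v)

xAff-∷ : ∀ {r} (a w : V n) (ws : Vec (V n) r) → xAff a (w ∷ ws) ≗ xAff a ws +ᵛ translate w (xAff a ws)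
xAff-∷ a w ws v =
  trans (sumL-allV-suc (λ c → e (a ⊕ comb c (w ∷ ws)) v))
        (cong (_+_ (xAff a ws v)) (cong sumL (List.map-cong shift (allV _))))
  where
  shift : ∀ c → e (a ⊕ (w ⊕ comb c ws)) v ≡ e (a ⊕ comb c ws) (w ⊕ v)
  shift c = trans (cong (λ p → e p v) (⊕-leftComm a w (comb c ws))) (e-translate w (a ⊕ comb c ws) v)

point-∈BW : ∀ n j k → n ℕ.+ j ≤ 2 ℕ.* k ℕ.+ 1 → BW n j (+ (2 ^ k) ·ᵛ e 0V)
point-∈BW zero    j k j≤2k+1 = ∣m⇒∣m*n {m = + (2 ^ k)} (e [] []) (∣ᵤ⇒∣ (2^⌊/2⌋∣2^ j k j≤2k+1))
point-∈BW (suc n) j k n+j<2k+1 =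
  BW-cong n j (λ v → cong (+ (2 ^ k) *_) (sym (e-0-false v))) (point-∈BW n j k (ℕ.<⇒≤ n+j<2k+1)) ,
  BW-cong n j (λ v → sym (ℤ.*-zeroʳ (+ (2 ^ k)))) (BW-0 n j) ,
  BW-cong n (suc j)
    (λ v → trans (a≡a-c*0 (+ (2 ^ k) * e 0V v) (+ (2 ^ k)))
                 (cong (λ t → + (2 ^ k) * t - + (2 ^ k) * + 0) (sym (e-0-false v))))
    (point-∈BW n (suc j) k (ℕ.≤-trans (ℕ.≤-reflexive (ℕ.+-suc n j)) n+j<2k+1))
  where
  a≡a-c*0 : ∀ a c → a ≡ a - c * + 0
  a≡a-c*0 = solve-∀

xAff-∈BW : ∀ n j k {r} (a : V n) (ws : Vec (V n) r) →
           n ℕ.+ j ≤ r ℕ.+ (2 ℕ.* k ℕ.+ 1) → BW n j (+ (2 ^ k) ·ᵛ xAff a ws)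
xAff-∈BW n j k a [] n+j≤2k+1 =
  BW-cong n j (λ v → cong (+ (2 ^ k) *_) (sym (xAff-[] a v))) (BW-translate n j a (point-∈BW n j k n+j≤2k+1))
xAff-∈BW n j k {suc r} a (w ∷ ws) n+j≤r+2k+2 =
  BW-half n j (BW-cong n (2 ℕ.+ j) double-xAff (BW-+translate n (suc j) w (xAff-∈BW n (suc j) (suc k) a ws bound)))
  where
  rearrange : ∀ r k → suc (suc r ℕ.+ (2 ℕ.* k ℕ.+ 1)) ≡ r ℕ.+ (2 ℕ.* suc k ℕ.+ 1)
  rearrange = ℕ.solve-∀
  bound : n ℕ.+ suc j ≤ r ℕ.+ (2 ℕ.* suc k ℕ.+ 1)
  bound = ℕ.≤-trans (ℕ.≤-reflexive (ℕ.+-suc n j))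
            (ℕ.≤-trans (s≤s n+j≤r+2k+2) (ℕ.≤-reflexive (rearrange r k)))
  double-xAff : ∀ v → + (2 ^ suc k) * xAff a ws v + + (2 ^ suc k) * xAff a ws (w ⊕ v)
                      ≡ + 2 * (+ (2 ^ k) * xAff a (w ∷ ws) v)
  double-xAff v = begin
    + (2 ^ suc k) * xAff a ws v + + (2 ^ suc k) * xAff a ws (w ⊕ v)
      ≡⟨ ℤ.*-distribˡ-+ (+ (2 ^ suc k)) (xAff a ws v) (xAff a ws (w ⊕ v)) ⟨
    + (2 ℕ.* 2 ^ k) * (xAff a ws v + xAff a ws (w ⊕ v))
      ≡⟨ cong₂ _*_ (ℤ.pos-* 2 (2 ^ k)) (sym (xAff-∷ a w ws v)) ⟩
    + 2 * + (2 ^ k) * xAff a (w ∷ ws) v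
      ≡⟨ ℤ.*-assoc (+ 2) (+ (2 ^ k)) (xAff a (w ∷ ws) v) ⟩
    + 2 * (+ (2 ^ k) * xAff a (w ∷ ws) v) ∎
    where open ≡-Reasoning

InLattice⊆BW : ∀ {m lam} j → (∀ s → s ℕ.+ j ≤ 2 ℕ.* lam s ℕ.+ 1) → ∀ {x} → InLattice m lam x → BW m j x
InLattice⊆BW {m} j bound zeroL = BW-0 m j
InLattice⊆BW {m} {lam} j bound (addGen r r≤m a w _ k x∈) =
  BW-+ m j (InLattice⊆BW j bound x∈) (BW-· m j k (xAff-∈BW m j (lam (m ∸ r)) a w m+j≤r+2λ+1))
  where
  open ℕ.≤-Reasoning
  m+j≤r+2λ+1 : m ℕ.+ j ≤ r ℕ.+ (2 ℕ.* lam (m ∸ r) ℕ.+ 1)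
  m+j≤r+2λ+1 = begin
    m ℕ.+ j                        ≡⟨ cong (ℕ._+ j) (ℕ.m+[n∸m]≡n r≤m) ⟨
    r ℕ.+ (m ∸ r) ℕ.+ j            ≡⟨ ℕ.+-assoc r (m ∸ r) j ⟩
    r ℕ.+ ((m ∸ r) ℕ.+ j)          ≤⟨ ℕ.+-monoʳ-≤ r (bound (m ∸ r)) ⟩
    r ℕ.+ (2 ℕ.* lam (m ∸ r) ℕ.+ 1) ∎
InLattice⊆BW {m} j bound (ext x∈ x≗y) = BW-cong m j x≗y (InLattice⊆BW j bound x∈)

s≤2*[s/2]+1 : ∀ s → s ≤ 2 ℕ.* (s ℕ./ 2) ℕ.+ 1
s≤2*[s/2]+1 s = begin
  s                      ≡⟨ m≡m%n+[m/n]*n s 2 ⟩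
  s ℕ.% 2 ℕ.+ s ℕ./ 2 ℕ.* 2 ≤⟨ ℕ.+-monoˡ-≤ (s ℕ./ 2 ℕ.* 2) (ℕ.≤-pred (m%n<n s 2)) ⟩
  1 ℕ.+ s ℕ./ 2 ℕ.* 2     ≡⟨ ℕ.+-comm 1 (s ℕ./ 2 ℕ.* 2) ⟩
  s ℕ./ 2 ℕ.* 2 ℕ.+ 1     ≡⟨ cong (ℕ._+ 1) (ℕ.*-comm (s ℕ./ 2) 2) ⟩
  2 ℕ.* (s ℕ./ 2) ℕ.+ 1   ∎
  where open ℕ.≤-Reasoning

Λ⊆BW : ∀ {m x} → Λ m x → BW m 0 x
Λ⊆BW = InLattice⊆BW 0 (λ s → ℕ.≤-trans (ℕ.≤-reflexive (ℕ.+-identityʳ s)) (s≤2*[s/2]+1 s))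

Δ⊆BW : ∀ {m x} → Δ m x → BW m 1 x
Δ⊆BW = InLattice⊆BW 1 (λ s → ℕ.≤-trans (ℕ.≤-reflexive (ℕ.+-comm s 1)) (s≤2*[s/2]+1 (suc s)))

normℕ : Vect n → ℕ
normℕ {zero}  x = ∣ x [] ∣ ℕ.* ∣ x [] ∣
normℕ {suc n} x = normℕ (lower x) ℕ.+ normℕ (upper x)

+∣a∣*∣a∣≡a*a : ∀ a → + (∣ a ∣ ℕ.* ∣ a ∣) ≡ a * a
+∣a∣*∣a∣≡a*a (+ m)    = ℤ.pos-* m m
+∣a∣*∣a∣≡a*a -[1+ m ] = refl

norm≡normℕ : ∀ (x : Vect n) → norm x ≡ + normℕ x
norm≡normℕ {zero}  x = trans (ℤ.+-identityʳ (x [] * x [])) (sym (+∣a∣*∣a∣≡a*a (x [])))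
norm≡normℕ {suc n} x = begin
  norm x                                      ≡⟨ sumL-allV-suc (λ v → x v * x v) ⟩
  norm (lower x) + norm (upper x)             ≡⟨ cong₂ _+_ (norm≡normℕ (lower x)) (norm≡normℕ (upper x)) ⟩
  + normℕ (lower x) + + normℕ (upper x)       ≡⟨ ℤ.pos-+ (normℕ (lower x)) (normℕ (upper x)) ⟨
  + normℕ x                                   ∎
  where open ≡-Reasoning

normℕ-cong : ∀ {x y : Vect n} → x ≗ y → normℕ x ≡ normℕ y
normℕ-cong {zero}  x≗y = cong (λ a → ∣ a ∣ ℕ.* ∣ a ∣) (x≗y [])
normℕ-cong {suc n} x≗y = cong₂ ℕ._+_ (normℕ-cong (x≗y ∘ (false ∷_))) (normℕ-cong (x≗y ∘ (true ∷_)))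

normℕ-neg : ∀ (x : Vect n) → normℕ (-ᵛ x) ≡ normℕ x
normℕ-neg {zero}  x = cong (λ m → m ℕ.* m) (ℤ.∣-i∣≡∣i∣ (x []))
normℕ-neg {suc n} x = cong₂ ℕ._+_ (normℕ-neg (lower x)) (normℕ-neg (upper x))

≗0ᵛ⇒normℕ≡0 : ∀ {x : Vect n} → x ≗ 0ᵛ → normℕ x ≡ 0
≗0ᵛ⇒normℕ≡0 {zero}  x≗0 rewrite x≗0 [] = refl
≗0ᵛ⇒normℕ≡0 {suc n} x≗0 = cong₂ ℕ._+_ (≗0ᵛ⇒normℕ≡0 (x≗0 ∘ (false ∷_))) (≗0ᵛ⇒normℕ≡0 (x≗0 ∘ (true ∷_)))

normℕ≡0⇒≗0ᵛ : ∀ {x : Vect n} → normℕ x ≡ 0 → x ≗ 0ᵛ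
normℕ≡0⇒≗0ᵛ {zero}  {x} ‖x‖≡0 [] = ℤ.∣i∣≡0⇒i≡0 (reduce (ℕ.m*n≡0⇒m≡0∨n≡0 ∣ x [] ∣ ‖x‖≡0))
normℕ≡0⇒≗0ᵛ {suc n} ‖x‖≡0 (false ∷ v) = normℕ≡0⇒≗0ᵛ (ℕ.m+n≡0⇒m≡0 _ ‖x‖≡0) v
normℕ≡0⇒≗0ᵛ {suc n} ‖x‖≡0 (true ∷ v)  = normℕ≡0⇒≗0ᵛ (ℕ.m+n≡0⇒n≡0 _ ‖x‖≡0) v

normℕ-double : ∀ (x : Vect n) → normℕ (+ 2 ·ᵛ x) ≡ 4 ℕ.* normℕ x
normℕ-double {zero}  x = begin
  ∣ + 2 * x [] ∣ ℕ.* ∣ + 2 * x [] ∣        ≡⟨ cong₂ ℕ._*_ (ℤ.abs-* (+ 2) (x [])) (ℤ.abs-* (+ 2) (x [])) ⟩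
  (2 ℕ.* ∣ x [] ∣) ℕ.* (2 ℕ.* ∣ x [] ∣)    ≡⟨ square-double ∣ x [] ∣ ⟩
  4 ℕ.* (∣ x [] ∣ ℕ.* ∣ x [] ∣)           ∎
  where
  open ≡-Reasoning
  square-double : ∀ m → (2 ℕ.* m) ℕ.* (2 ℕ.* m) ≡ 4 ℕ.* (m ℕ.* m)
  square-double = ℕ.solve-∀
normℕ-double {suc n} x =
  trans (cong₂ ℕ._+_ (normℕ-double (lower x)) (normℕ-double (upper x)))
        (sym (ℕ.*-distribˡ-+ 4 (normℕ (lower x)) (normℕ (upper x))))

parallelogram : ∀ (x y : Vect n) → normℕ (x +ᵛ y) ℕ.+ normℕ (x -ᵛ y) ≡ 2 ℕ.* (normℕ x ℕ.+ normℕ y)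
parallelogram {zero} x y = ℤ.+-injective (begin
  + (normℕ (x +ᵛ y) ℕ.+ normℕ (x -ᵛ y))         ≡⟨ ℤ.pos-+ (normℕ (x +ᵛ y)) (normℕ (x -ᵛ y)) ⟩
  + normℕ (x +ᵛ y) + + normℕ (x -ᵛ y)           ≡⟨ cong₂ _+_ (+∣a∣*∣a∣≡a*a (a + b)) (+∣a∣*∣a∣≡a*a (a - b)) ⟩
  (a + b) * (a + b) + (a - b) * (a - b)        ≡⟨ parallelogramℤ a b ⟩
  + 2 * (a * a + b * b)                        ≡⟨ cong (+ 2 *_) (cong₂ _+_ (+∣a∣*∣a∣≡a*a a) (+∣a∣*∣a∣≡a*a b)) ⟨
  + 2 * (+ normℕ x + + normℕ y)                ≡⟨ cong (+ 2 *_) (ℤ.pos-+ (normℕ x) (normℕ y)) ⟨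
  + 2 * + (normℕ x ℕ.+ normℕ y)                ≡⟨ ℤ.pos-* 2 (normℕ x ℕ.+ normℕ y) ⟨
  + (2 ℕ.* (normℕ x ℕ.+ normℕ y))              ∎)
  where
  open ≡-Reasoning
  a = x []
  b = y []
  parallelogramℤ : ∀ a b → (a + b) * (a + b) + (a - b) * (a - b) ≡ + 2 * (a * a + b * b)
  parallelogramℤ = solve-∀
parallelogram {suc n} x y = begin
  (P₀ ℕ.+ P₁) ℕ.+ (M₀ ℕ.+ M₁)          ≡⟨ +-interchange P₀ P₁ M₀ M₁ ⟩
  (P₀ ℕ.+ M₀) ℕ.+ (P₁ ℕ.+ M₁)
    ≡⟨ cong₂ ℕ._+_ (parallelogram (lower x) (lower y)) (parallelogram (upper x) (upper y)) ⟩
  2 ℕ.* (X₀ ℕ.+ Y₀) ℕ.+ 2 ℕ.* (X₁ ℕ.+ Y₁) ≡⟨ regroup X₀ Y₀ X₁ Y₁ ⟩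
  2 ℕ.* ((X₀ ℕ.+ X₁) ℕ.+ (Y₀ ℕ.+ Y₁))    ∎
  where
  open ≡-Reasoning
  P₀ = normℕ (lower x +ᵛ lower y)
  P₁ = normℕ (upper x +ᵛ upper y)
  M₀ = normℕ (lower x -ᵛ lower y)
  M₁ = normℕ (upper x -ᵛ upper y)
  X₀ = normℕ (lower x)
  X₁ = normℕ (upper x)
  Y₀ = normℕ (lower y)
  Y₁ = normℕ (upper y)
  regroup : ∀ a b c d → 2 ℕ.* (a ℕ.+ b) ℕ.+ 2 ℕ.* (c ℕ.+ d) ≡ 2 ℕ.* ((a ℕ.+ c) ℕ.+ (b ℕ.+ d))
  regroup = ℕ.solve-∀

hadamard : Vect (suc n) → Vect (suc n)
hadamard x = (lower x +ᵛ upper x) ∥ (lower x -ᵛ upper x)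

normℕ-hadamard : ∀ (x : Vect (suc n)) → normℕ (hadamard x) ≡ 2 ℕ.* normℕ x
normℕ-hadamard x = parallelogram (lower x) (upper x)

BW-hadamard : ∀ n j {x : Vect (suc n)} → BW (suc n) j x → BW (suc n) (suc j) (hadamard x)
BW-hadamard n j {x} (x₀∈ , x₁∈ , x₀-x₁∈) =
  BW-cong n (suc j) (λ v → sum-via-diff (x (false ∷ v)) (x (true ∷ v)))
    (BW-+ n (suc j) x₀-x₁∈ (BW-weaken n (suc j) (BW-double n j x₁∈))) ,
  x₀-x₁∈ ,
  BW-cong n (2 ℕ.+ j) (λ v → double-via-diff (x (false ∷ v)) (x (true ∷ v))) (BW-double n j x₁∈)
  where
  sum-via-diff : ∀ a b → (a - b) + + 2 * b ≡ a + b
  sum-via-diff = solve-∀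
  double-via-diff : ∀ a b → + 2 * b ≡ (a + b) - (a - b)
  double-via-diff = solve-∀

2^≤2^⌊/2⌋²+2^⌊/2⌋² : ∀ j → 2 ^ j ≤ 2^⌊ j /2⌋ ℕ.* 2^⌊ j /2⌋ ℕ.+ 2^⌊ j /2⌋ ℕ.* 2^⌊ j /2⌋
2^≤2^⌊/2⌋²+2^⌊/2⌋² 0 = s≤s z≤n
2^≤2^⌊/2⌋²+2^⌊/2⌋² 1 = ℕ.≤-refl
2^≤2^⌊/2⌋²+2^⌊/2⌋² (suc (suc j)) = begin
  2 ℕ.* (2 ℕ.* 2 ^ j)                    ≡⟨ ℕ.*-assoc 2 2 (2 ^ j) ⟨
  4 ℕ.* 2 ^ j                            ≤⟨ ℕ.*-monoʳ-≤ 4 (2^≤2^⌊/2⌋²+2^⌊/2⌋² j) ⟩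
  4 ℕ.* (p ℕ.* p ℕ.+ p ℕ.* p)            ≡⟨ rearrange p ⟩
  2 ℕ.* p ℕ.* (2 ℕ.* p) ℕ.+ 2 ℕ.* p ℕ.* (2 ℕ.* p) ∎
  where
  open ℕ.≤-Reasoning
  p = 2^⌊ j /2⌋
  rearrange : ∀ p → 4 ℕ.* (p ℕ.* p ℕ.+ p ℕ.* p) ≡ 2 ℕ.* p ℕ.* (2 ℕ.* p) ℕ.+ 2 ℕ.* p ℕ.* (2 ℕ.* p)
  rearrange = ℕ.solve-∀

2^≤2^⌊suc/2⌋² : ∀ j → 2 ^ j ≤ 2^⌊ suc j /2⌋ ℕ.* 2^⌊ suc j /2⌋
2^≤2^⌊suc/2⌋² 0 = ℕ.≤-refl
2^≤2^⌊suc/2⌋² 1 = s≤s (s≤s z≤n)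
2^≤2^⌊suc/2⌋² (suc (suc j)) = begin
  2 ℕ.* (2 ℕ.* 2 ^ j)        ≡⟨ ℕ.*-assoc 2 2 (2 ^ j) ⟨
  4 ℕ.* 2 ^ j                ≤⟨ ℕ.*-monoʳ-≤ 4 (2^≤2^⌊suc/2⌋² j) ⟩
  4 ℕ.* (p ℕ.* p)            ≡⟨ rearrange p ⟩
  2 ℕ.* p ℕ.* (2 ℕ.* p)      ∎
  where
  open ℕ.≤-Reasoning
  p = 2^⌊ suc j /2⌋
  rearrange : ∀ p → 4 ℕ.* (p ℕ.* p) ≡ 2 ℕ.* p ℕ.* (2 ℕ.* p)
  rearrange = ℕ.solve-∀

ZeroOr≥ : ℕ → ℕ → Set
ZeroOr≥ b m = m ≡ 0 ⊎ b ≤ m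

MinAtLeast : ℕ → ℕ → ℕ → Set
MinAtLeast n j b = ∀ (x : Vect n) → BW n j x → ZeroOr≥ b (normℕ x)

BW₀-min : ∀ j → MinAtLeast 0 j (2^⌊ j /2⌋ ℕ.* 2^⌊ j /2⌋)
BW₀-min j x x∈ with ∣ x [] ∣ | ∣⇒∣ᵤ x∈
... | zero  | _   = inj₁ refl
... | suc m | p∣m = inj₂ (ℕ.*-mono-≤ (ℕ.∣⇒≤ p∣m) (ℕ.∣⇒≤ p∣m))

normℕ-via-diffˡ : ∀ {x : Vect (suc n)} → normℕ (lower x) ≡ 0 → normℕ x ≡ normℕ (lower x -ᵛ upper x)
normℕ-via-diffˡ {x = x} ‖x₀‖≡0 = begin
  normℕ (lower x) ℕ.+ normℕ (upper x)   ≡⟨ cong (ℕ._+ normℕ (upper x)) ‖x₀‖≡0 ⟩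
  normℕ (upper x)                       ≡⟨ normℕ-neg (upper x) ⟨
  normℕ (-ᵛ upper x)                    ≡⟨ normℕ-cong x₀-x₁≗-x₁ ⟨
  normℕ (lower x -ᵛ upper x)            ∎
  where
  open ≡-Reasoning
  x₀-x₁≗-x₁ : lower x -ᵛ upper x ≗ -ᵛ upper x
  x₀-x₁≗-x₁ v = trans (cong (_- upper x v) (normℕ≡0⇒≗0ᵛ ‖x₀‖≡0 v)) (ℤ.+-identityˡ (- upper x v))

normℕ-via-diffʳ : ∀ {x : Vect (suc n)} → normℕ (upper x) ≡ 0 → normℕ x ≡ normℕ (lower x -ᵛ upper x)
normℕ-via-diffʳ {x = x} ‖x₁‖≡0 = begin
  normℕ (lower x) ℕ.+ normℕ (upper x)   ≡⟨ cong (normℕ (lower x) ℕ.+_) ‖x₁‖≡0 ⟩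
  normℕ (lower x) ℕ.+ 0                 ≡⟨ ℕ.+-identityʳ (normℕ (lower x)) ⟩
  normℕ (lower x)                       ≡⟨ normℕ-cong x₀-x₁≗x₀ ⟨
  normℕ (lower x -ᵛ upper x)            ∎
  where
  open ≡-Reasoning
  x₀-x₁≗x₀ : lower x -ᵛ upper x ≗ lower x
  x₀-x₁≗x₀ v = trans (cong (_-_ (lower x v)) (normℕ≡0⇒≗0ᵛ ‖x₁‖≡0 v)) (ℤ.+-identityʳ (lower x v))

BW-suc-min : ∀ n j {b b′ c} → MinAtLeast n j b → MinAtLeast n (suc j) b′ → c ≤ b ℕ.+ b → c ≤ b′ →
             MinAtLeast (suc n) j c
BW-suc-min n j {c = c} min₀ min₁ c≤b+b c≤b′ x (x₀∈ , x₁∈ , x₀-x₁∈)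
  with min₀ (lower x) x₀∈ | min₀ (upper x) x₁∈
... | inj₂ b≤‖x₀‖ | inj₂ b≤‖x₁‖ = inj₂ (ℕ.≤-trans c≤b+b (ℕ.+-mono-≤ b≤‖x₀‖ b≤‖x₁‖))
... | inj₁ ‖x₀‖≡0 | _           =
  subst (ZeroOr≥ c) (sym (normℕ-via-diffˡ {x = x} ‖x₀‖≡0))
    (Data.Sum.map₂ (ℕ.≤-trans c≤b′) (min₁ (lower x -ᵛ upper x) x₀-x₁∈))
... | inj₂ _      | inj₁ ‖x₁‖≡0 =
  subst (ZeroOr≥ c) (sym (normℕ-via-diffʳ {x = x} ‖x₁‖≡0))
    (Data.Sum.map₂ (ℕ.≤-trans c≤b′) (min₁ (lower x -ᵛ upper x) x₀-x₁∈))

BW-min : ∀ n j → MinAtLeast (suc n) j (2 ^ (j ℕ.+ n))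
BW-min zero j rewrite ℕ.+-identityʳ j =
  BW-suc-min 0 j (BW₀-min j) (BW₀-min (suc j)) (2^≤2^⌊/2⌋²+2^⌊/2⌋² j) (2^≤2^⌊suc/2⌋² j)
BW-min (suc n) j =
  BW-suc-min (suc n) j (BW-min n j) (BW-min n (suc j))
    (ℕ.≤-reflexive (trans (cong (2 ^_) (ℕ.+-suc j n)) (cong (2 ^ (j ℕ.+ n) ℕ.+_) (ℕ.+-identityʳ _))))
    (ℕ.≤-reflexive (cong (2 ^_) (ℕ.+-suc j n)))

record Symmetry (n : ℕ) : Set where
  field
    act       : V n → V n
    BW-act    : ∀ j {x} → BW n j x → BW n j (x ∘ act)
    normℕ-act : ∀ x → normℕ (x ∘ act) ≡ normℕ x

open Symmetry

idˢ : Symmetry n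
idˢ = record { act = λ v → v ; BW-act = λ j x∈ → x∈ ; normℕ-act = λ x → refl }

_∘ˢ_ : Symmetry n → Symmetry n → Symmetry n
g ∘ˢ h = record
  { act       = act g ∘ act h
  ; BW-act    = λ j x∈ → BW-act h j (BW-act g j x∈)
  ; normℕ-act = λ x → trans (normℕ-act h (x ∘ act g)) (normℕ-act g x)
  }

liftˢ : Symmetry n → Symmetry (suc n)
liftˢ {n} g = record { act = act′ ; BW-act = BW-act′ ; normℕ-act = normℕ-act′ }
  where
  act′ : V (suc n) → V (suc n)
  act′ (b ∷ v) = b ∷ act g v
  BW-act′ : ∀ j {x} → BW (suc n) j x → BW (suc n) j (x ∘ act′)
  BW-act′ j (x₀∈ , x₁∈ , x₀-x₁∈) = BW-act g j x₀∈ , BW-act g j x₁∈ , BW-act g (suc j) x₀-x₁∈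
  normℕ-act′ : ∀ x → normℕ (x ∘ act′) ≡ normℕ x
  normℕ-act′ x = cong₂ ℕ._+_ (normℕ-act g (lower x)) (normℕ-act g (upper x))

flipˢ : Symmetry (suc n)
flipˢ {n} = record
  { act = act′ ; BW-act = BW-act′ ; normℕ-act = λ x → ℕ.+-comm (normℕ (upper x)) (normℕ (lower x)) }
  where
  act′ : V (suc n) → V (suc n)
  act′ (b ∷ v) = not b ∷ v
  BW-act′ : ∀ j {x} → BW (suc n) j x → BW (suc n) j (x ∘ act′)
  BW-act′ j {x} (x₀∈ , x₁∈ , x₀-x₁∈) =
    x₁∈ , x₀∈ , BW-cong n (suc j) (λ v → neg-sub (lower x v) (upper x v)) (BW-neg n (suc j) x₀-x₁∈)

swapˢ : Symmetry (2 ℕ.+ n)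
swapˢ {n} = record { act = act′ ; BW-act = BW-act′ ; normℕ-act = normℕ-act′ }
  where
  act′ : V (2 ℕ.+ n) → V (2 ℕ.+ n)
  act′ (b ∷ c ∷ v) = c ∷ b ∷ v
  swap-diffs : ∀ a b c d → (a - c) - (b - d) ≡ (a - b) - (c - d)
  swap-diffs = solve-∀
  BW-act′ : ∀ j {x} → BW (2 ℕ.+ n) j x → BW (2 ℕ.+ n) j (x ∘ act′)
  BW-act′ j {x} ((x₀₀∈ , x₀₁∈ , x₀₀-x₀₁∈) , (x₁₀∈ , x₁₁∈ , x₁₀-x₁₁∈) , (x₀₀-x₁₀∈ , x₀₁-x₁₁∈ , d∈)) =
    (x₀₀∈ , x₁₀∈ , x₀₀-x₁₀∈) , (x₀₁∈ , x₁₁∈ , x₀₁-x₁₁∈) ,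
    (x₀₀-x₀₁∈ , x₁₀-x₁₁∈ ,
     BW-cong n (2 ℕ.+ j)
       (λ v → swap-diffs (x (false ∷ false ∷ v)) (x (false ∷ true ∷ v))
                         (x (true ∷ false ∷ v)) (x (true ∷ true ∷ v)))
       d∈)
  normℕ-act′ : ∀ x → normℕ (x ∘ act′) ≡ normℕ x
  normℕ-act′ x = +-interchange (normℕ (lower (lower x))) (normℕ (lower (upper x)))
                                (normℕ (upper (lower x))) (normℕ (upper (upper x)))

shearˢ : Symmetry (2 ℕ.+ n)
shearˢ {n} = record { act = act′ ; BW-act = BW-act′ ; normℕ-act = normℕ-act′ }
  where
  act′ : V (2 ℕ.+ n) → V (2 ℕ.+ n)
  act′ (b ∷ c ∷ v) = (b xor c) ∷ c ∷ v
  BW-act′ : ∀ j {x} → BW (2 ℕ.+ n) j x → BW (2 ℕ.+ n) j (x ∘ act′)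
  BW-act′ j {x} ((x₀₀∈ , x₀₁∈ , x₀₀-x₀₁∈) , (x₁₀∈ , x₁₁∈ , x₁₀-x₁₁∈) , (x₀₀-x₁₀∈ , x₀₁-x₁₁∈ , d∈)) =
    (x₀₀∈ , x₁₁∈ ,
     BW-cong n (suc j) (λ v → sub-telescope (x₀₀ v) (x₀₁ v) (x₁₁ v)) (BW-+ n (suc j) x₀₀-x₀₁∈ x₀₁-x₁₁∈)) ,
    (x₁₀∈ , x₀₁∈ ,
     BW-cong n (suc j) (λ v → sub-cancel (x₀₁ v) (x₁₀ v) (x₁₁ v)) (BW-- n (suc j) x₁₀-x₁₁∈ x₀₁-x₁₁∈)) ,
    (x₀₀-x₁₀∈ , BW-cong n (suc j) (λ v → neg-sub (x₀₁ v) (x₁₁ v)) (BW-neg n (suc j) x₀₁-x₁₁∈) ,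
     BW-cong n (2 ℕ.+ j) (λ v → add-twice (x₀₀ v) (x₀₁ v) (x₁₀ v) (x₁₁ v))
       (BW-+ n (2 ℕ.+ j) d∈ (BW-weaken n (2 ℕ.+ j) (BW-double n (suc j) x₀₁-x₁₁∈))))
    where
    x₀₀ x₀₁ x₁₀ x₁₁ : Vect n
    x₀₀ v = x (false ∷ false ∷ v)
    x₀₁ v = x (false ∷ true ∷ v)
    x₁₀ v = x (true ∷ false ∷ v)
    x₁₁ v = x (true ∷ true ∷ v)
    sub-telescope : ∀ a b d → (a - b) + (b - d) ≡ a - d
    sub-telescope = solve-∀
    sub-cancel : ∀ b c d → (c - d) - (b - d) ≡ c - b
    sub-cancel = solve-∀
    add-twice : ∀ a b c d → ((a - c) - (b - d)) + + 2 * (b - d) ≡ (a - c) - (d - b)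
    add-twice = solve-∀
  normℕ-act′ : ∀ x → normℕ (x ∘ act′) ≡ normℕ x
  normℕ-act′ x = regroup (normℕ (lower (lower x))) (normℕ (upper (lower x)))
                         (normℕ (lower (upper x))) (normℕ (upper (upper x)))
    where
    regroup : ∀ a b c d → (a ℕ.+ d) ℕ.+ (c ℕ.+ b) ≡ (a ℕ.+ b) ℕ.+ (c ℕ.+ d)
    regroup = ℕ.solve-∀

nonzero⇒≥ : ∀ {b m} → ZeroOr≥ b m → m ≢ 0 → b ≤ m
nonzero⇒≥ (inj₁ m≡0) m≢0 = ⊥-elim (m≢0 m≡0)
nonzero⇒≥ (inj₂ b≤m) _   = b≤m

2*a≡a+a : ∀ a → 2 ℕ.* a ≡ a ℕ.+ a
2*a≡a+a a = cong (a ℕ.+_) (ℕ.+-identityʳ a)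

≥-halves⇒≡ : ∀ {a A B} → a ≤ A → a ≤ B → A ℕ.+ B ≡ 2 ℕ.* a → A ≡ a
≥-halves⇒≡ {a} {A} {B} a≤A a≤B A+B≡2a = ℕ.≤-antisym A≤a a≤A
  where
  A≤a : A ≤ a
  A≤a = ℕ.+-cancelʳ-≤ a A a (ℕ.≤-trans (ℕ.+-monoʳ-≤ A a≤B) (ℕ.≤-reflexive (trans A+B≡2a (2*a≡a+a a))))

rest≡0 : ∀ {a X P Q} → X ℕ.+ (P ℕ.+ Q) ≡ 2 ℕ.* a → X ≡ a → a ≤ P → Q ≡ 0
rest≡0 {a} {X} {P} {Q} sum≡2a refl a≤P = ℕ.n≤0⇒n≡0 (ℕ.+-cancelˡ-≤ P Q 0 P+Q≤P+0)
  where
  P+Q≡a : P ℕ.+ Q ≡ a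
  P+Q≡a = ℕ.+-cancelˡ-≡ a (P ℕ.+ Q) a (trans sum≡2a (2*a≡a+a a))
  P+Q≤P+0 : P ℕ.+ Q ≤ P ℕ.+ 0
  P+Q≤P+0 = ℕ.≤-trans (ℕ.≤-reflexive P+Q≡a) (ℕ.≤-trans a≤P (ℕ.≤-reflexive (sym (ℕ.+-identityʳ P))))

-- z vanishes on the quarter 00. Unless swapping the first two coordinates finishes, (0 , z₁₀) is a
-- nonzero vector of BW (n+1) 0, so ‖z₁₀‖ ≥ 2^n and the norm count forces z₁₁ = 0; the shear
-- (b , c) ↦ (b xor c , c) then puts the quarters 00 and 11 into the lower half.
swapOrShear : ∀ n (z : Vect (2 ℕ.+ n)) → BW (2 ℕ.+ n) 0 z → normℕ z ≡ 2 ^ suc n →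
              normℕ (lower z) ≡ 2 ^ n → lower (lower z) ≗ 0ᵛ →
              Σ (Symmetry (2 ℕ.+ n)) λ g → lower (z ∘ act g) ≗ 0ᵛ
swapOrShear n z z∈ ‖z‖ ‖z₀‖ z₀₀≗0 with normℕ (lower (z ∘ act swapˢ)) ℕ.≟ 0
... | yes ‖w₀‖≡0 = swapˢ , normℕ≡0⇒≗0ᵛ ‖w₀‖≡0
... | no  ‖w₀‖≢0 = shearˢ , z₀₀∥z₁₁≗0
  where
  2^n≤‖z₁₀‖ : 2 ^ n ≤ normℕ (lower (upper z))
  2^n≤‖z₁₀‖ = subst (2 ^ n ≤_) (cong (ℕ._+ normℕ (lower (upper z))) (≗0ᵛ⇒normℕ≡0 z₀₀≗0))
    (nonzero⇒≥ (BW-min n 0 (lower (z ∘ act swapˢ)) (proj₁ (BW-act swapˢ 0 {z} z∈))) ‖w₀‖≢0)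
  ‖z₁₁‖≡0 : normℕ (upper (upper z)) ≡ 0
  ‖z₁₁‖≡0 = rest≡0 ‖z‖ ‖z₀‖ 2^n≤‖z₁₀‖
  z₀₀∥z₁₁≗0 : lower (z ∘ act shearˢ) ≗ 0ᵛ
  z₀₀∥z₁₁≗0 (false ∷ v) = z₀₀≗0 v
  z₀₀∥z₁₁≗0 (true ∷ v)  = normℕ≡0⇒≗0ᵛ ‖z₁₁‖≡0 v

minimal-normalForm : ∀ n (x : Vect (suc n)) → BW (suc n) 0 x → normℕ x ≡ 2 ^ n →
                     Σ (Symmetry (suc n)) λ g → lower (x ∘ act g) ≗ 0ᵛ
minimal-normalForm n x x∈ ‖x‖ with normℕ (lower x) ℕ.≟ 0 | normℕ (upper x) ℕ.≟ 0
... | yes ‖x₀‖≡0 | _          = idˢ , normℕ≡0⇒≗0ᵛ ‖x₀‖≡0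
... | no _       | yes ‖x₁‖≡0 = flipˢ , normℕ≡0⇒≗0ᵛ ‖x₁‖≡0
minimal-normalForm zero x x∈ ‖x‖ | no ‖x₀‖≢0 | no ‖x₁‖≢0 =
  ⊥-elim (ℕ.<-irrefl (sym ‖x‖) (ℕ.+-mono-≤ (ℕ.n≢0⇒n>0 ‖x₀‖≢0) (ℕ.n≢0⇒n>0 ‖x₁‖≢0)))
minimal-normalForm (suc n) x x∈@(x₀∈ , x₁∈ , _) ‖x‖ | no ‖x₀‖≢0 | no ‖x₁‖≢0 =
  liftˢ g ∘ˢ proj₁ lastStep , proj₂ lastStep
  where
  ‖x₀‖≡2^n : normℕ (lower x) ≡ 2 ^ n
  ‖x₀‖≡2^n = ≥-halves⇒≡ (nonzero⇒≥ (BW-min n 0 (lower x) x₀∈) ‖x₀‖≢0)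
                        (nonzero⇒≥ (BW-min n 0 (upper x) x₁∈) ‖x₁‖≢0) ‖x‖
  normalForm₀ : Σ (Symmetry (suc n)) λ g → lower (lower x ∘ act g) ≗ 0ᵛ
  normalForm₀ = minimal-normalForm n (lower x) x₀∈ ‖x₀‖≡2^n
  g : Symmetry (suc n)
  g = proj₁ normalForm₀
  lastStep : Σ (Symmetry (2 ℕ.+ n)) λ h → lower (x ∘ act (liftˢ g) ∘ act h) ≗ 0ᵛ
  lastStep = swapOrShear n (x ∘ act (liftˢ g)) (BW-act (liftˢ g) 0 {x} x∈)
    (trans (normℕ-act (liftˢ g) x) ‖x‖) (trans (normℕ-act g (lower x)) ‖x₀‖≡2^n) (proj₂ normalForm₀)

a+b≡0⇒a≡-b : ∀ a b → a + b ≡ + 0 → a ≡ - b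
a+b≡0⇒a≡-b a b a+b≡0 = trans (a≡[a+b]-b a b) (trans (cong (_- b) a+b≡0) (ℤ.+-identityˡ (- b)))
  where
  a≡[a+b]-b : ∀ a b → a ≡ (a + b) - b
  a≡[a+b]-b = solve-∀

hadamard-+ : ∀ (x y : Vect (suc n)) → hadamard (x +ᵛ y) ≗ hadamard x +ᵛ hadamard y
hadamard-+ x y (false ∷ v) = +-interchangeℤ (lower x v) (lower y v) (upper x v) (upper y v)
hadamard-+ x y (true ∷ v)  = sym (sub-interchange (lower x v) (upper x v) (lower y v) (upper y v))

normℕ-hadamard≗2· : ∀ {x y : Vect (suc n)} → hadamard x ≗ + 2 ·ᵛ y → normℕ x ≡ 2 ℕ.* normℕ y
normℕ-hadamard≗2· {x = x} {y} hx≗2y = ℕ.*-cancelˡ-≡ (normℕ x) (2 ℕ.* normℕ y) 2 (begin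
  2 ℕ.* normℕ x              ≡⟨ normℕ-hadamard x ⟨
  normℕ (hadamard x)         ≡⟨ normℕ-cong hx≗2y ⟩
  normℕ (+ 2 ·ᵛ y)           ≡⟨ normℕ-double y ⟩
  4 ℕ.* normℕ y              ≡⟨ ℕ.*-assoc 2 2 (normℕ y) ⟩
  2 ℕ.* (2 ℕ.* normℕ y)      ∎)
  where open ≡-Reasoning

EqOrAtLeastDouble : ℕ → ℕ → Set
EqOrAtLeastDouble a m = m ≡ a ⊎ 2 ℕ.* a ≤ m

nonzero⇒≡1⊎≥2 : ∀ m → m ≢ 0 → EqOrAtLeastDouble 1 m
nonzero⇒≡1⊎≥2 zero          m≢0 = ⊥-elim (m≢0 refl)
nonzero⇒≡1⊎≥2 1             _   = inj₁ refl
nonzero⇒≡1⊎≥2 (suc (suc m)) _   = inj₂ (s≤s (s≤s z≤n))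

NormGap : ℕ → ℕ → Set
NormGap n j = ∀ (ℓ d : Vect (suc n)) → BW (suc n) j ℓ → normℕ ℓ ≡ 2 ^ (j ℕ.+ n) → BW (suc n) (suc j) d →
              EqOrAtLeastDouble (2 ^ (j ℕ.+ n)) (normℕ (ℓ +ᵛ d))

normGap-base : NormGap 0 0
normGap-base ℓ d ℓ∈ ‖ℓ‖≡1 d∈ with normℕ (ℓ +ᵛ d) ℕ.≟ 0
... | no ‖ℓ+d‖≢0 = nonzero⇒≡1⊎≥2 (normℕ (ℓ +ᵛ d)) ‖ℓ+d‖≢0
... | yes ‖ℓ+d‖≡0 = ⊥-elim (¬ZeroOr≥2-1 (subst (ZeroOr≥ 2) ‖ℓ‖≡1 (BW-min 0 1 ℓ ℓ∈Δ)))
  where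
  ℓ∈Δ : BW 1 1 ℓ
  ℓ∈Δ = BW-cong 1 1 (λ v → sym (a+b≡0⇒a≡-b (ℓ v) (d v) (normℕ≡0⇒≗0ᵛ {x = ℓ +ᵛ d} ‖ℓ+d‖≡0 v)))
          (BW-neg 1 1 {d} d∈)
  ¬ZeroOr≥2-1 : ¬ ZeroOr≥ 2 1
  ¬ZeroOr≥2-1 (inj₁ ())
  ¬ZeroOr≥2-1 (inj₂ (s≤s ()))

normGap-suc-j : ∀ n j → NormGap n j → NormGap n (suc j)
normGap-suc-j n j gap s e s∈ ‖s‖ e∈ =
  subst (EqOrAtLeastDouble (2 ^ suc (j ℕ.+ n))) (sym ‖s+e‖≡2‖ℓ+d‖) (double (gap ℓ d ℓ∈ ‖ℓ‖ d∈))
  where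
  halfS : Σ (Vect (suc n)) λ ℓ → hadamard s ≗ + 2 ·ᵛ ℓ × BW (suc n) j ℓ
  halfS = BW-halve (suc n) j (BW-hadamard n (suc j) {s} s∈)
  halfE : Σ (Vect (suc n)) λ d → hadamard e ≗ + 2 ·ᵛ d × BW (suc n) (suc j) d
  halfE = BW-halve (suc n) (suc j) (BW-hadamard n (2 ℕ.+ j) {e} e∈)
  ℓ d : Vect (suc n)
  ℓ = proj₁ halfS
  d = proj₁ halfE
  ℓ∈ : BW (suc n) j ℓ
  ℓ∈ = proj₂ (proj₂ halfS)
  d∈ : BW (suc n) (suc j) d
  d∈ = proj₂ (proj₂ halfE)
  ‖ℓ‖ : normℕ ℓ ≡ 2 ^ (j ℕ.+ n)
  ‖ℓ‖ = ℕ.*-cancelˡ-≡ (normℕ ℓ) (2 ^ (j ℕ.+ n)) 2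
          (trans (sym (normℕ-hadamard≗2· {x = s} (proj₁ (proj₂ halfS)))) ‖s‖)
  h[s+e]≗2[ℓ+d] : hadamard (s +ᵛ e) ≗ + 2 ·ᵛ (ℓ +ᵛ d)
  h[s+e]≗2[ℓ+d] v = trans (hadamard-+ s e v)
    (trans (cong₂ _+_ (proj₁ (proj₂ halfS) v) (proj₁ (proj₂ halfE) v))
           (sym (ℤ.*-distribˡ-+ (+ 2) (ℓ v) (d v))))
  ‖s+e‖≡2‖ℓ+d‖ : normℕ (s +ᵛ e) ≡ 2 ℕ.* normℕ (ℓ +ᵛ d)
  ‖s+e‖≡2‖ℓ+d‖ = normℕ-hadamard≗2· {x = s +ᵛ e} h[s+e]≗2[ℓ+d]
  double : ∀ {a m} → EqOrAtLeastDouble a m → EqOrAtLeastDouble (2 ℕ.* a) (2 ℕ.* m)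
  double (inj₁ m≡a)   = inj₁ (cong (2 ℕ.*_) m≡a)
  double (inj₂ 2a≤m)  = inj₂ (ℕ.*-monoʳ-≤ 2 2a≤m)

normGap-halves : ∀ n → NormGap n 1 → ∀ (b c c′ : Vect (suc n)) → BW (suc n) 1 b → normℕ b ≡ 2 ^ suc n →
                 BW (suc n) 1 c → BW (suc n) 1 c′ → BW (suc n) 2 (c -ᵛ c′) →
                 EqOrAtLeastDouble (2 ^ suc n) (normℕ c ℕ.+ normℕ (b +ᵛ c′))
normGap-halves n gap b c c′ b∈ ‖b‖ c∈ c′∈ c-c′∈ with normℕ c ℕ.≟ 0 | normℕ (b +ᵛ c′) ℕ.≟ 0
... | yes ‖c‖≡0 | _ =
  subst (EqOrAtLeastDouble (2 ^ suc n)) (cong (ℕ._+ normℕ (b +ᵛ c′)) (sym ‖c‖≡0)) (gap b c′ b∈ ‖b‖ c′∈₂)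
  where
  c′∈₂ : BW (suc n) 2 c′
  c′∈₂ = BW-cong (suc n) 2
           (λ v → trans (cong (λ a → - (a - c′ v)) (normℕ≡0⇒≗0ᵛ {x = c} ‖c‖≡0 v)) (neg[0-a]≡a (c′ v)))
           (BW-neg (suc n) 2 {c -ᵛ c′} c-c′∈)
... | no ‖c‖≢0 | no ‖b+c′‖≢0 =
  inj₂ (ℕ.≤-trans (ℕ.≤-reflexive (2*a≡a+a (2 ^ suc n)))
         (ℕ.+-mono-≤ (nonzero⇒≥ (BW-min n 1 c c∈) ‖c‖≢0)
                     (nonzero⇒≥ (BW-min n 1 (b +ᵛ c′) (BW-+ (suc n) 1 {b} {c′} b∈ c′∈)) ‖b+c′‖≢0)))
... | no _ | yes ‖b+c′‖≡0 =
  subst (EqOrAtLeastDouble (2 ^ suc n)) ‖-b+[c-c′]‖≡‖c‖+‖b+c′‖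
    (gap (-ᵛ b) (c -ᵛ c′) (BW-neg (suc n) 1 {b} b∈) (trans (normℕ-neg b) ‖b‖) c-c′∈)
  where
  -b+[c-c′]≗c : (-ᵛ b) +ᵛ (c -ᵛ c′) ≗ c
  -b+[c-c′]≗c v = trans (cong (λ a → - a + (c v - c′ v)) b≡-c′) (cancel (c v) (c′ v))
    where
    b≡-c′ : b v ≡ - c′ v
    b≡-c′ = a+b≡0⇒a≡-b (b v) (c′ v) (normℕ≡0⇒≗0ᵛ {x = b +ᵛ c′} ‖b+c′‖≡0 v)
    cancel : ∀ c c′ → - (- c′) + (c - c′) ≡ c
    cancel = solve-∀
  ‖-b+[c-c′]‖≡‖c‖+‖b+c′‖ : normℕ ((-ᵛ b) +ᵛ (c -ᵛ c′)) ≡ normℕ c ℕ.+ normℕ (b +ᵛ c′)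
  ‖-b+[c-c′]‖≡‖c‖+‖b+c′‖ =
    trans (normℕ-cong -b+[c-c′]≗c) (sym (trans (cong (normℕ c ℕ.+_) ‖b+c′‖≡0) (ℕ.+-identityʳ (normℕ c))))

normGap-lowerZero : ∀ n → NormGap n 1 → ∀ (ℓ d : Vect (2 ℕ.+ n)) → BW (2 ℕ.+ n) 0 ℓ → lower ℓ ≗ 0ᵛ →
                    normℕ ℓ ≡ 2 ^ suc n → BW (2 ℕ.+ n) 1 d → EqOrAtLeastDouble (2 ^ suc n) (normℕ (ℓ +ᵛ d))
normGap-lowerZero n gap ℓ d (_ , _ , ℓ₀-ℓ₁∈) ℓ₀≗0 ‖ℓ‖ (c∈ , c′∈ , c-c′∈) =
  subst (EqOrAtLeastDouble (2 ^ suc n)) (sym ‖ℓ+d‖≡‖c‖+‖b+c′‖)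
    (normGap-halves n gap b (lower d) (upper d) b∈ ‖b‖ c∈ c′∈ c-c′∈)
  where
  b : Vect (suc n)
  b = upper ℓ
  b∈ : BW (suc n) 1 b
  b∈ = BW-cong (suc n) 1 (λ v → trans (cong (λ a → - (a - b v)) (ℓ₀≗0 v)) (neg[0-a]≡a (b v)))
         (BW-neg (suc n) 1 {lower ℓ -ᵛ b} ℓ₀-ℓ₁∈)
  ‖b‖ : normℕ b ≡ 2 ^ suc n
  ‖b‖ = trans (cong (ℕ._+ normℕ b) (sym (≗0ᵛ⇒normℕ≡0 ℓ₀≗0))) ‖ℓ‖
  ‖ℓ+d‖≡‖c‖+‖b+c′‖ : normℕ (ℓ +ᵛ d) ≡ normℕ (lower d) ℕ.+ normℕ (b +ᵛ upper d)
  ‖ℓ+d‖≡‖c‖+‖b+c′‖ = cong (ℕ._+ normℕ (b +ᵛ upper d))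
    (normℕ-cong (λ v → trans (cong (_+ lower d v) (ℓ₀≗0 v)) (ℤ.+-identityˡ (lower d v))))

normGap-suc-n : ∀ n → NormGap n 1 → NormGap (suc n) 0
normGap-suc-n n gap ℓ d ℓ∈ ‖ℓ‖ d∈ =
  subst (EqOrAtLeastDouble (2 ^ suc n)) (normℕ-act g (ℓ +ᵛ d))
    (normGap-lowerZero n gap (ℓ ∘ act g) (d ∘ act g) (BW-act g 0 {ℓ} ℓ∈) (proj₂ normalForm)
      (trans (normℕ-act g ℓ) ‖ℓ‖) (BW-act g 1 {d} d∈))
  where
  normalForm : Σ (Symmetry (2 ℕ.+ n)) λ g → lower (ℓ ∘ act g) ≗ 0ᵛ
  normalForm = minimal-normalForm (suc n) ℓ ℓ∈ ‖ℓ‖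
  g : Symmetry (2 ℕ.+ n)
  g = proj₁ normalForm

normGap : ∀ n → NormGap n 0
normGap zero    = normGap-base
normGap (suc n) = normGap-suc-n n (normGap-suc-j n 0 (normGap n))

mainTheorem2 : (m : ℕ) → 1 ≤ m → (ℓ : Vect m) → Λ m ℓ →
    norm ℓ ≡ + (2 ^ (m ∸ 1)) →
    (d : Vect m) → Δ m d →
    norm (λ v → ℓ v + d v) ≡ + (2 ^ (m ∸ 1)) ⊎ + (2 ^ m) ≤ℤ norm (λ v → ℓ v + d v)
mainTheorem2 zero    () _ _ _ _ _
mainTheorem2 (suc n) _ ℓ ℓ∈Λ ‖ℓ‖ d d∈Δ =
  toℤ (normGap n ℓ d (Λ⊆BW ℓ∈Λ) (ℤ.+-injective (trans (sym (norm≡normℕ ℓ)) ‖ℓ‖)) (Δ⊆BW d∈Δ))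
  where
  toℤ : EqOrAtLeastDouble (2 ^ n) (normℕ (ℓ +ᵛ d)) →
        norm (ℓ +ᵛ d) ≡ + (2 ^ n) ⊎ + (2 ^ suc n) ≤ℤ norm (ℓ +ᵛ d)
  toℤ rewrite norm≡normℕ (ℓ +ᵛ d) = Data.Sum.map (cong (λ m → + m)) ℤ.+≤+
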